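{- For every $m$-by-$n$ $(0,1,\ast)$-matrix $A$, $\mathrm{mr}(A)=\min\{\mathrm{rk}(H): H \text{ a } (0,1)\text{ -matrix with } n \text{ columns such that } H\mathbf{x}\neq\mathbf{0}\text{ for all }\mathbf{x}\in K_A\}$.
   Context: A $(0,1,\ast)$-matrix has entries in $\{0,1,\ast\}$; arithmetic and ranks are over $GF_2$. A completion of $A$ is obtained by replacing each $\ast$ by $0$ or $1$; $\mathrm{mr}(A)$ is the minimum rank of a completion. For $A=(a_{ij})$ and $i\in[m]$, let $\mathbf{a}_i$ be the $i$th row of $A$ with all stars set to $0$, and $D_i$ the diagonal $n$-by-$n$ $(0,1)$-matrix whose $j$th diagonal entry is $1$ iff $a_{ij}=\ast$. Then $K_A=\{\mathbf{x}\in\{0,1\}^n:\exists i\ D_i\mathbf{x}=\mathbf{0}\text{ and }\langle\mathbf{a}_i,\mathbf{x}\rangle=1\}$. -}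

module Defs where

open import Data.Bool using (Bool; true; false; _∧_; _xor_)
open import Data.Nat using (ℕ; zero; suc; _≤_)
open import Data.Fin using (Fin; zero; suc)
open import Data.Product using (Σ; ∃; ∃-syntax; _×_; _,_)
open import Relation.Binary.PropositionalEquality using (_≡_)
open import Relation.Nullary using (¬_)

-- GF(2) is modelled by Bool: addition = _xor_, multiplication = _∧_.

data Entry : Set where
  𝟘 𝟙 ∗ : Entry

Mat : Set → ℕ → ℕ → Set
Mat X m n = Fin m → Fin n → X

Vec₂ : ℕ → Set
Vec₂ n = Fin n → Bool

Σ₂ : ∀ n → (Fin n → Bool) → Bool
Σ₂ zero    f = false
Σ₂ (suc n) f = f zero xor Σ₂ n (λ j → f (suc j))

⟨_,_⟩ : ∀ {n} → Vec₂ n → Vec₂ n → Bool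
⟨_,_⟩ {n} a x = Σ₂ n (λ j → a j ∧ x j)

_·_ : ∀ {k n} → Mat Bool k n → Vec₂ n → Vec₂ k
(H · x) i = ⟨ H i , x ⟩

IsZero : ∀ {n} → Vec₂ n → Set
IsZero {n} v = ∀ j → v j ≡ false

LinIndep : ∀ {k n} → (Fin k → Vec₂ n) → Set
LinIndep {k} {n} v =
  ∀ (c : Fin k → Bool) → IsZero (λ j → Σ₂ k (λ i → c i ∧ v i j)) → IsZero c

IsRank : ∀ {m n} → Mat Bool m n → ℕ → Set
IsRank {m} {n} M r =
  (Σ (Fin r → Fin m) λ f → LinIndep (λ i → M (f i)))
  × (∀ k (f : Fin k → Fin m) → LinIndep (λ i → M (f i)) → k ≤ r)

data Agrees : Entry → Bool → Set where
  agree𝟘 : Agrees 𝟘 false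
  agree𝟙 : Agrees 𝟙 true
  agree∗ : ∀ b → Agrees ∗ b

IsCompletion : ∀ {m n} → Mat Entry m n → Mat Bool m n → Set
IsCompletion A C = ∀ i j → Agrees (A i j) (C i j)

IsMinRank : ∀ {m n} → Mat Entry m n → ℕ → Set
IsMinRank A r =
  (Σ _ λ C → IsCompletion A C × IsRank C r)
  × (∀ C → IsCompletion A C → ∀ s → IsRank C s → r ≤ s)

isStar : Entry → Bool
isStar ∗ = true
isStar _ = false

starToZero : Entry → Bool
starToZero 𝟙 = true
starToZero _ = false

rowVec : ∀ {m n} → Mat Entry m n → Fin m → Vec₂ n
rowVec A i j = starToZero (A i j)

D : ∀ {m n} → Mat Entry m n → Fin m → Mat Bool n n
D A i j j' with j Data.Fin.≟ j'
... | Relation.Nullary.yes _ = isStar (A i j)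
... | Relation.Nullary.no  _ = false

InK : ∀ {m n} → Mat Entry m n → Vec₂ n → Set
InK A x = ∃[ i ] (IsZero (D A i · x) × ⟨ rowVec A i , x ⟩ ≡ true)

Separates : ∀ {m n k} → Mat Entry m n → Mat Bool k n → Set
Separates A H = ∀ x → InK A x → ¬ IsZero (H · x)

IsMinSepRank : ∀ {m n} → Mat Entry m n → ℕ → Set
IsMinSepRank {m} {n} A r =
  (Σ ℕ λ k → Σ (Mat Bool k n) λ H → Separates A H × IsRank H r)
  × (∀ k (H : Mat Bool k n) → Separates A H → ∀ s → IsRank H s → r ≤ s)

-- Every completion C of A separates K_A: if x ∈ K_A through row i, then x vanishes on the stars
-- of row i, so ⟨C i , x⟩ = ⟨a_i , x⟩ = 1. Conversely, let H separate K_A. For each row i, the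
-- Fredholm alternative restricted to the non-star positions of row i yields either a combination
-- of the rows of H agreeing with a_i off its stars, or an x vanishing on those stars with Hx = 0
-- and ⟨a_i , x⟩ = 1, i.e. an x ∈ K_A with Hx = 0, which is excluded. These combinations form a
-- completion whose rows lie in the row space of H, so its rank is at most rk H. Hence a completion
-- of minimum rank (found by exhaustive search) realises both minima.
module Submission where

open import Defs
open import Data.Nat using (ℕ)
open import Data.Product using (∃-syntax; _×_)

open import Algebra.Bundles using (CommutativeRing)
open import Data.Bool.Base using (Bool; true; false; _∧_; _xor_; not)
open import Data.Bool.Properties using
  ( ∧-zeroʳ; ∧-identityʳ; ∧-assoc; ∧-comm; ∧-distribˡ-xor; ∧-distribʳ-xor
  ; xor-identityʳ; xor-same; xor-comm; ¬-not; xor-∧-commutativeRing )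
  renaming (_≟_ to _≟ᵇ_)
open import Algebra.Properties.CommutativeSemigroup
  (CommutativeRing.+-commutativeSemigroup xor-∧-commutativeRing)
  using (interchange; x∙yz≈y∙xz)
open import Data.Nat using (zero; suc; _≤_; z≤n; s≤s)
open import Data.Nat.Properties using (≤-trans; ≤-antisym; m≤n⇒m≤1+n)
open import Data.Fin using (Fin; zero; suc; punchIn; _≟_)
open import Data.Fin.Properties using (any?; all?; punchInᵢ≢i)
open import Data.Vec.Functional using ([]; _∷_; insertAt; removeAt)
open import Data.Vec.Functional.Properties using (insertAt-lookup; insertAt-punchIn)
import Data.List as List
open List using (List; filter; cartesianProductWith)
open import Data.List.Membership.Propositional using (_∈_)
open import Data.List.Membership.Propositional.Properties
  using (∈-cartesianProductWith⁺; ∈-filter⁺)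
open import Data.List.Relation.Unary.Any using (here; there)
import Data.List.Relation.Unary.All as All
open import Data.List.Relation.Unary.All.Properties using (all-filter)
open import Data.List.Extrema.Nat using (argmin; argmin-all; f[argmin]≤f[xs])
open import Data.Product using (Σ-syntax; _,_; proj₁; proj₂)
open import Data.Sum using (_⊎_; inj₁; inj₂)
open import Function using (_∘_; const)
open import Relation.Binary.PropositionalEquality
  using (_≡_; _≢_; _≗_; refl; sym; trans; cong; cong₂; subst; module ≡-Reasoning)
open import Relation.Nullary using (Dec; yes; no; does; contradiction)
open import Relation.Nullary.Decidable using (_×-dec_)
open import Relation.Unary using (Decidable)

open ≡-Reasoning

Σ₂-cong : ∀ n {f g : Fin n → Bool} → f ≗ g → Σ₂ n f ≡ Σ₂ n g
Σ₂-cong zero    f≗g = refl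
Σ₂-cong (suc n) f≗g = cong₂ _xor_ (f≗g zero) (Σ₂-cong n (f≗g ∘ suc))

Σ₂-zero : ∀ n {f : Fin n → Bool} → f ≗ const false → Σ₂ n f ≡ false
Σ₂-zero zero    f≗0 = refl
Σ₂-zero (suc n) f≗0 = cong₂ _xor_ (f≗0 zero) (Σ₂-zero n (f≗0 ∘ suc))

Σ₂-distrib-xor : ∀ n (f g : Fin n → Bool) →
                 Σ₂ n (λ j → f j xor g j) ≡ Σ₂ n f xor Σ₂ n g
Σ₂-distrib-xor zero    f g = refl
Σ₂-distrib-xor (suc n) f g =
  trans (cong ((f zero xor g zero) xor_) (Σ₂-distrib-xor n (f ∘ suc) (g ∘ suc)))
        (interchange (f zero) (g zero) _ _)

∧-distribˡ-Σ₂ : ∀ n b (f : Fin n → Bool) → b ∧ Σ₂ n f ≡ Σ₂ n (λ j → b ∧ f j)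
∧-distribˡ-Σ₂ zero    b f = ∧-zeroʳ b
∧-distribˡ-Σ₂ (suc n) b f =
  trans (∧-distribˡ-xor b (f zero) _) (cong ((b ∧ f zero) xor_) (∧-distribˡ-Σ₂ n b (f ∘ suc)))

∧-distribʳ-Σ₂ : ∀ n b (f : Fin n → Bool) → Σ₂ n f ∧ b ≡ Σ₂ n (λ j → f j ∧ b)
∧-distribʳ-Σ₂ n b f = begin
  Σ₂ n f ∧ b                ≡⟨ ∧-comm (Σ₂ n f) b ⟩
  b ∧ Σ₂ n f                ≡⟨ ∧-distribˡ-Σ₂ n b f ⟩
  Σ₂ n (λ j → b ∧ f j)      ≡⟨ Σ₂-cong n (λ j → ∧-comm b (f j)) ⟩
  Σ₂ n (λ j → f j ∧ b)      ∎

Σ₂-comm : ∀ m n (f : Fin m → Fin n → Bool) →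
          Σ₂ m (λ i → Σ₂ n (f i)) ≡ Σ₂ n (λ j → Σ₂ m (λ i → f i j))
Σ₂-comm zero    n f = sym (Σ₂-zero n (λ _ → refl))
Σ₂-comm (suc m) n f =
  trans (cong (Σ₂ n (f zero) xor_) (Σ₂-comm m n (f ∘ suc)))
        (sym (Σ₂-distrib-xor n (f zero) _))

Σ₂-remove : ∀ n (f : Fin (suc n) → Bool) p → Σ₂ (suc n) f ≡ f p xor Σ₂ n (removeAt f p)
Σ₂-remove n       f zero    = refl
Σ₂-remove (suc n) f (suc p) =
  trans (cong (f zero xor_) (Σ₂-remove n (f ∘ suc) p)) (x∙yz≈y∙xz (f zero) (f (suc p)) _)

Σ₂-single : ∀ {n} (f : Fin (suc n) → Bool) j → (∀ j′ → j′ ≢ j → f j′ ≡ false) →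
            Σ₂ (suc n) f ≡ f j
Σ₂-single {n} f j others = begin
  Σ₂ (suc n) f                    ≡⟨ Σ₂-remove n f j ⟩
  f j xor Σ₂ n (removeAt f j)     ≡⟨ cong (f j xor_) (Σ₂-zero n (λ i → others _ (punchInᵢ≢i j i))) ⟩
  f j xor false                   ≡⟨ xor-identityʳ (f j) ⟩
  f j                             ∎

_⊕_ : ∀ {n} → Vec₂ n → Vec₂ n → Vec₂ n
(u ⊕ v) j = u j xor v j

⟨⟩-⊕ˡ : ∀ {n} (u v x : Vec₂ n) → ⟨ u ⊕ v , x ⟩ ≡ ⟨ u , x ⟩ xor ⟨ v , x ⟩
⟨⟩-⊕ˡ {n} u v x = trans (Σ₂-cong n (λ j → ∧-distribʳ-xor (x j) (u j) (v j))) (Σ₂-distrib-xor n _ _)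

⟨⟩-⊕ʳ : ∀ {n} (u x y : Vec₂ n) → ⟨ u , x ⊕ y ⟩ ≡ ⟨ u , x ⟩ xor ⟨ u , y ⟩
⟨⟩-⊕ʳ {n} u x y = trans (Σ₂-cong n (λ j → ∧-distribˡ-xor (u j) (x j) (y j))) (Σ₂-distrib-xor n _ _)

unit : ∀ {n} → Fin n → Vec₂ n
unit j j′ = does (j ≟ j′)

⟨⟩-unitʳ : ∀ {n} (a : Vec₂ n) j → ⟨ a , unit j ⟩ ≡ a j
⟨⟩-unitʳ {suc n} a j = trans (Σ₂-single _ j off-diagonal) on-diagonal
  where
  off-diagonal : ∀ j′ → j′ ≢ j → a j′ ∧ unit j j′ ≡ false
  off-diagonal j′ j′≢j with j ≟ j′
  ... | yes j≡j′ = contradiction (sym j≡j′) j′≢j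
  ... | no  _    = ∧-zeroʳ (a j′)
  on-diagonal : a j ∧ unit j j ≡ a j
  on-diagonal with j ≟ j
  ... | yes _   = ∧-identityʳ (a j)
  ... | no  j≢j = contradiction refl j≢j

lincomb : ∀ {k n} → (Fin k → Bool) → (Fin k → Vec₂ n) → Vec₂ n
lincomb {k} c v j = Σ₂ k (λ i → c i ∧ v i j)

lincomb-congʳ : ∀ {k n} (c : Fin k → Bool) {v w : Fin k → Vec₂ n} →
                (∀ i → v i ≗ w i) → lincomb c v ≗ lincomb c w
lincomb-congʳ {k} c v≗w j = Σ₂-cong k (λ i → cong (c i ∧_) (v≗w i j))

lincomb-lincomb : ∀ {k r n} (d : Fin k → Bool) (C : Fin k → Vec₂ r) (w : Fin r → Vec₂ n) →
                  lincomb d (λ i → lincomb (C i) w) ≗ lincomb (lincomb d C) w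
lincomb-lincomb {k} {r} d C w j = begin
  Σ₂ k (λ i → d i ∧ Σ₂ r (λ l → C i l ∧ w l j))    ≡⟨ Σ₂-cong k (λ i → ∧-distribˡ-Σ₂ r (d i) _) ⟩
  Σ₂ k (λ i → Σ₂ r (λ l → d i ∧ (C i l ∧ w l j)))  ≡⟨ Σ₂-comm k r _ ⟩
  Σ₂ r (λ l → Σ₂ k (λ i → d i ∧ (C i l ∧ w l j)))  ≡⟨ Σ₂-cong r (λ l → Σ₂-cong k (λ i → sym (∧-assoc (d i) _ _))) ⟩
  Σ₂ r (λ l → Σ₂ k (λ i → (d i ∧ C i l) ∧ w l j))  ≡⟨ Σ₂-cong r (λ l → sym (∧-distribʳ-Σ₂ k (w l j) _)) ⟩
  Σ₂ r (λ l → Σ₂ k (λ i → d i ∧ C i l) ∧ w l j)    ∎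

lincomb-⟨⟩ : ∀ {k n} (c : Fin k → Bool) (v : Fin k → Vec₂ n) x →
             ⟨ lincomb c v , x ⟩ ≡ Σ₂ k (λ i → c i ∧ ⟨ v i , x ⟩)
lincomb-⟨⟩ {k} {n} c v x = begin
  Σ₂ n (λ j → Σ₂ k (λ i → c i ∧ v i j) ∧ x j)    ≡⟨ Σ₂-cong n (λ j → ∧-distribʳ-Σ₂ k (x j) _) ⟩
  Σ₂ n (λ j → Σ₂ k (λ i → (c i ∧ v i j) ∧ x j))  ≡⟨ Σ₂-comm n k _ ⟩
  Σ₂ k (λ i → Σ₂ n (λ j → (c i ∧ v i j) ∧ x j))  ≡⟨ Σ₂-cong k (λ i → Σ₂-cong n (λ j → ∧-assoc (c i) _ _)) ⟩
  Σ₂ k (λ i → Σ₂ n (λ j → c i ∧ (v i j ∧ x j)))  ≡⟨ Σ₂-cong k (λ i → sym (∧-distribˡ-Σ₂ n (c i) _)) ⟩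
  Σ₂ k (λ i → c i ∧ ⟨ v i , x ⟩)                 ∎

lincomb-insertAt : ∀ {t n} (c : Fin t → Bool) p b (u : Fin (suc t) → Vec₂ n) j →
                   lincomb (insertAt c p b) u j ≡ (b ∧ u p j) xor lincomb c (removeAt u p) j
lincomb-insertAt {t} c p b u j =
  trans (Σ₂-remove t (λ i → insertAt c p b i ∧ u i j) p)
        (cong₂ _xor_ (cong (_∧ u p j) (insertAt-lookup c p b))
                     (Σ₂-cong t (λ i → cong (_∧ u (punchIn p i) j) (insertAt-punchIn c p b i))))

LinIndep-resp : ∀ {k n} {v w : Fin k → Vec₂ n} → (∀ i → v i ≗ w i) → LinIndep v → LinIndep w
LinIndep-resp v≗w indep c c·w≡0 = indep c (λ j → trans (lincomb-congʳ c v≗w j) (c·w≡0 j))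

_⟂_ : ∀ {k n} → (Fin k → Vec₂ n) → Vec₂ n → Set
h ⟂ x = ∀ l → ⟨ h l , x ⟩ ≡ false

LinIndep-∷ : ∀ {r n} (h : Vec₂ n) {w : Fin r → Vec₂ n} {x : Vec₂ n} →
             LinIndep w → w ⟂ x → ⟨ h , x ⟩ ≡ true → LinIndep (h ∷ w)
LinIndep-∷ {r} {n} h {w} {x} w-indep w⟂x hx≡1 c c·hw≡0 = c≡0
  where
  c₀≡0 : c zero ≡ false
  c₀≡0 = begin
    c zero                                      ≡⟨ sym (xor-identityʳ (c zero)) ⟩
    c zero xor false                            ≡⟨ cong₂ _xor_ (trans (cong (c zero ∧_) hx≡1) (∧-identityʳ _))
                                                               (Σ₂-zero r (λ i → trans (cong (c (suc i) ∧_) (w⟂x i)) (∧-zeroʳ _))) ⟨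
    Σ₂ (suc r) (λ i → c i ∧ ⟨ (h ∷ w) i , x ⟩)   ≡⟨ lincomb-⟨⟩ c (h ∷ w) x ⟨
    ⟨ lincomb c (h ∷ w) , x ⟩                   ≡⟨ Σ₂-zero n (λ j → cong (_∧ x j) (c·hw≡0 j)) ⟩
    false                                       ∎
  c≡0 : IsZero c
  c≡0 zero    = c₀≡0
  c≡0 (suc i) = w-indep (c ∘ suc) (λ j → trans (cong (λ b → (b ∧ h j) xor lincomb (c ∘ suc) w j) (sym c₀≡0)) (c·hw≡0 j)) i

AgreeOn : ∀ {n} → (Fin n → Bool) → Vec₂ n → Vec₂ n → Set
AgreeOn S u v = ∀ j → S j ≡ true → u j ≡ v j

VanishesOff : ∀ {n} → (Fin n → Bool) → Vec₂ n → Set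
VanishesOff S x = ∀ j → S j ≡ false → x j ≡ false

Obstruction : ∀ {k n} → (Fin n → Bool) → (Fin k → Vec₂ n) → Vec₂ n → Set
Obstruction S h a = ∃[ x ] VanishesOff S x × h ⟂ x × ⟨ a , x ⟩ ≡ true

unit-obstruction : ∀ {n} {h : Fin 0 → Vec₂ n} (S : Fin n → Bool) (a : Vec₂ n) j →
                   S j ≡ true → a j ≡ true → Obstruction S h a
unit-obstruction S a j Sj≡1 aj≡1 = unit j , vanishes , (λ ()) , trans (⟨⟩-unitʳ a j) aj≡1
  where
  vanishes : VanishesOff S (unit j)
  vanishes j′ Sj′≡0 with j ≟ j′
  ... | yes refl = contradiction (trans (sym Sj≡1) Sj′≡0) λ ()
  ... | no  _    = refl

-- Either x or y is orthogonal to h zero, or else x ⊕ y is.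
obstruction-suc : ∀ {k n} {S : Fin n → Bool} {h : Fin (suc k) → Vec₂ n} {a : Vec₂ n} →
                  Obstruction S (h ∘ suc) a → Obstruction S (h ∘ suc) (a ⊕ h zero) →
                  Obstruction S h a
obstruction-suc {S = S} {h} {a} (x , x-off , h⟂x , ax≡1) (y , y-off , h⟂y , a⊕h₀y≡1)
  with ⟨ h zero , x ⟩ in h₀x | ⟨ h zero , y ⟩ in h₀y
... | false | _     = x , x-off , (λ { zero → h₀x ; (suc l) → h⟂x l }) , ax≡1
... | true  | false = y , y-off , (λ { zero → h₀y ; (suc l) → h⟂y l }) , ay≡1
  where
  ay≡1 : ⟨ a , y ⟩ ≡ true
  ay≡1 = begin
    ⟨ a , y ⟩                     ≡⟨ xor-identityʳ _ ⟨
    ⟨ a , y ⟩ xor false           ≡⟨ cong (⟨ a , y ⟩ xor_) h₀y ⟨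
    ⟨ a , y ⟩ xor ⟨ h zero , y ⟩   ≡⟨ ⟨⟩-⊕ˡ a (h zero) y ⟨
    ⟨ a ⊕ h zero , y ⟩            ≡⟨ a⊕h₀y≡1 ⟩
    true                          ∎
... | true  | true  = x ⊕ y , x⊕y-off , h⟂x⊕y , a[x⊕y]≡1
  where
  x⊕y-off : VanishesOff S (x ⊕ y)
  x⊕y-off j Sj≡0 = cong₂ _xor_ (x-off j Sj≡0) (y-off j Sj≡0)
  h⟂x⊕y : h ⟂ (x ⊕ y)
  h⟂x⊕y zero    = trans (⟨⟩-⊕ʳ (h zero) x y) (cong₂ _xor_ h₀x h₀y)
  h⟂x⊕y (suc l) = trans (⟨⟩-⊕ʳ (h (suc l)) x y) (cong₂ _xor_ (h⟂x l) (h⟂y l))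
  a[x⊕y]≡1 : ⟨ a , x ⊕ y ⟩ ≡ true
  a[x⊕y]≡1 = begin
    ⟨ a , x ⊕ y ⟩                 ≡⟨ ⟨⟩-⊕ʳ a x y ⟩
    ⟨ a , x ⟩ xor ⟨ a , y ⟩        ≡⟨ cong (_xor ⟨ a , y ⟩) ax≡1 ⟩
    true xor ⟨ a , y ⟩             ≡⟨ xor-comm true _ ⟩
    ⟨ a , y ⟩ xor true             ≡⟨ cong (⟨ a , y ⟩ xor_) h₀y ⟨
    ⟨ a , y ⟩ xor ⟨ h zero , y ⟩   ≡⟨ ⟨⟩-⊕ˡ a (h zero) y ⟨
    ⟨ a ⊕ h zero , y ⟩            ≡⟨ a⊕h₀y≡1 ⟩
    true                          ∎

-- Fredholm alternative over GF(2), for agreement on the coordinates in S only.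
combination-or-obstruction : ∀ {n} k (S : Fin n → Bool) (h : Fin k → Vec₂ n) (a : Vec₂ n) →
                             (∃[ c ] AgreeOn S (lincomb c h) a) ⊎ Obstruction S h a
combination-or-obstruction zero S h a with any? (λ j → (S j ≟ᵇ true) ×-dec (a j ≟ᵇ true))
... | yes (j , Sj≡1 , aj≡1) = inj₂ (unit-obstruction S a j Sj≡1 aj≡1)
... | no  ∄j                = inj₁ ([] , λ j Sj≡1 → sym (¬-not (λ aj≡1 → ∄j (j , Sj≡1 , aj≡1))))
combination-or-obstruction (suc k) S h a
  with combination-or-obstruction k S (h ∘ suc) a
     | combination-or-obstruction k S (h ∘ suc) (a ⊕ h zero)
... | inj₁ (c , agree) | _                = inj₁ (false ∷ c , agree)
... | inj₂ _           | inj₁ (c , agree) = inj₁ (true ∷ c , λ j Sj≡1 → begin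
  h zero j xor lincomb c (h ∘ suc) j       ≡⟨ cong (h zero j xor_) (agree j Sj≡1) ⟩
  h zero j xor (a j xor h zero j)          ≡⟨ x∙yz≈y∙xz (h zero j) (a j) (h zero j) ⟩
  a j xor (h zero j xor h zero j)          ≡⟨ cong (a j xor_) (xor-same (h zero j)) ⟩
  a j xor false                            ≡⟨ xor-identityʳ (a j) ⟩
  a j                                      ∎)
... | inj₂ o           | inj₂ o′           = inj₂ (obstruction-suc o o′)

-- One step of Gaussian elimination on the first coordinate, with pivot u p.
eliminate : ∀ {s t} → (Fin (suc t) → Vec₂ (suc s)) → Fin (suc t) → Fin t → Vec₂ s
eliminate u p i j = u (punchIn p i) (suc j) xor (u (punchIn p i) zero ∧ u p (suc j))

-- A dependency c′ of the eliminated family lifts to one of u, with coefficient l₀ on the pivot.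
eliminate-LinIndep : ∀ {s t} (u : Fin (suc t) → Vec₂ (suc s)) p → u p zero ≡ true →
                     LinIndep u → LinIndep (eliminate u p)
eliminate-LinIndep {s} {t} u p pivot u-indep c′ c′·e≡0 i =
  trans (sym (insertAt-punchIn c′ p l₀ i)) (u-indep c c·u≡0 (punchIn p i))
  where
  w : Fin t → Vec₂ (suc s)
  w = removeAt u p
  l₀ : Bool
  l₀ = lincomb c′ w zero
  c : Fin (suc t) → Bool
  c = insertAt c′ p l₀
  c′·e : ∀ j → lincomb c′ (eliminate u p) j ≡ lincomb c′ w (suc j) xor (l₀ ∧ u p (suc j))
  c′·e j = begin
    Σ₂ t (λ i → c′ i ∧ (w i (suc j) xor (w i zero ∧ u p (suc j))))
      ≡⟨ Σ₂-cong t (λ i → ∧-distribˡ-xor (c′ i) _ _) ⟩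
    Σ₂ t (λ i → (c′ i ∧ w i (suc j)) xor (c′ i ∧ (w i zero ∧ u p (suc j))))
      ≡⟨ Σ₂-distrib-xor t _ _ ⟩
    lincomb c′ w (suc j) xor Σ₂ t (λ i → c′ i ∧ (w i zero ∧ u p (suc j)))
      ≡⟨ cong (lincomb c′ w (suc j) xor_) (Σ₂-cong t (λ i → sym (∧-assoc (c′ i) _ _))) ⟩
    lincomb c′ w (suc j) xor Σ₂ t (λ i → (c′ i ∧ w i zero) ∧ u p (suc j))
      ≡⟨ cong (lincomb c′ w (suc j) xor_) (∧-distribʳ-Σ₂ t (u p (suc j)) _) ⟨
    lincomb c′ w (suc j) xor (l₀ ∧ u p (suc j))
      ∎
  c·u≡0 : IsZero (lincomb c u)
  c·u≡0 zero = begin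
    lincomb c u zero                ≡⟨ lincomb-insertAt c′ p l₀ u zero ⟩
    (l₀ ∧ u p zero) xor l₀          ≡⟨ cong (λ b → (l₀ ∧ b) xor l₀) pivot ⟩
    (l₀ ∧ true) xor l₀              ≡⟨ cong (_xor l₀) (∧-identityʳ l₀) ⟩
    l₀ xor l₀                       ≡⟨ xor-same l₀ ⟩
    false                           ∎
  c·u≡0 (suc j) = begin
    lincomb c u (suc j)                              ≡⟨ lincomb-insertAt c′ p l₀ u (suc j) ⟩
    (l₀ ∧ u p (suc j)) xor lincomb c′ w (suc j)      ≡⟨ xor-comm (l₀ ∧ u p (suc j)) _ ⟩
    lincomb c′ w (suc j) xor (l₀ ∧ u p (suc j))      ≡⟨ c′·e j ⟨
    lincomb c′ (eliminate u p) j                     ≡⟨ c′·e≡0 j ⟩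
    false                                            ∎

LinIndep⇒≤ : ∀ s {t} (u : Fin t → Vec₂ s) → LinIndep u → t ≤ s
LinIndep⇒≤ _       {zero}  u u-indep = z≤n
LinIndep⇒≤ zero    {suc t} u u-indep with u-indep (const true) (λ ()) zero
... | ()
LinIndep⇒≤ (suc s) {suc t} u u-indep with any? (λ i → u i zero ≟ᵇ true)
... | yes (p , pivot) = s≤s (LinIndep⇒≤ s (eliminate u p) (eliminate-LinIndep u p pivot u-indep))
... | no  ∄pivot      = m≤n⇒m≤1+n (LinIndep⇒≤ s (λ i → u i ∘ suc) tails-indep)
  where
  tails-indep : LinIndep (λ i → u i ∘ suc)
  tails-indep c c·tails≡0 = u-indep c λ
    { zero    → Σ₂-zero (suc t) (λ i → trans (cong (c i ∧_) (¬-not (∄pivot ∘ (i ,_)))) (∧-zeroʳ (c i)))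
    ; (suc j) → c·tails≡0 j }

SpannedBy : ∀ {m r n} → (Fin m → Vec₂ n) → (Fin r → Vec₂ n) → Set
SpannedBy {r = r} v w = ∀ l → Σ[ c ∈ (Fin r → Bool) ] v l ≗ lincomb c w

SpannedBy-trans : ∀ {m k r n} {u : Fin m → Vec₂ n} {v : Fin k → Vec₂ n} {w : Fin r → Vec₂ n} →
                  SpannedBy u v → SpannedBy v w → SpannedBy u w
SpannedBy-trans {k = k} {r = r} {u = u} {v = v} {w = w} u≤v v≤w l = lincomb c C , λ j → begin
  u l j                                ≡⟨ proj₂ (u≤v l) j ⟩
  lincomb c v j                        ≡⟨ lincomb-congʳ c (proj₂ ∘ v≤w) j ⟩
  lincomb c (λ i → lincomb (C i) w) j  ≡⟨ lincomb-lincomb c C w j ⟩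
  lincomb (lincomb c C) w j            ∎
  where
  c : Fin k → Bool
  c = proj₁ (u≤v l)
  C : Fin k → Vec₂ r
  C = proj₁ ∘ v≤w

LinIndep-SpannedBy⇒≤ : ∀ {k r n} {v : Fin k → Vec₂ n} {w : Fin r → Vec₂ n} →
                       SpannedBy v w → LinIndep v → k ≤ r
LinIndep-SpannedBy⇒≤ {k} {r} {v = v} {w} v≤w v-indep = LinIndep⇒≤ r C C-indep
  where
  C : Fin k → Vec₂ r
  C = proj₁ ∘ v≤w
  C-indep : LinIndep C
  C-indep d d·C≡0 = v-indep d λ j → begin
    lincomb d v j                        ≡⟨ lincomb-congʳ d (proj₂ ∘ v≤w) j ⟩
    lincomb d (λ i → lincomb (C i) w) j  ≡⟨ lincomb-lincomb d C w j ⟩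
    lincomb (lincomb d C) w j            ≡⟨ Σ₂-zero r (λ l → cong (_∧ w l j) (d·C≡0 l)) ⟩
    false                                ∎

basis : ∀ {n} m (M : Mat Bool m n) →
        ∃[ r ] Σ[ f ∈ (Fin r → Fin m) ] LinIndep (M ∘ f) × SpannedBy M (M ∘ f)
basis zero    M = 0 , (λ ()) , (λ _ _ ()) , (λ ())
basis (suc m) M with basis m (M ∘ suc)
... | r , f , indep , spans with combination-or-obstruction r (const true) (M ∘ suc ∘ f) (M zero)
...   | inj₁ (c , agree) = r , suc ∘ f , indep , λ
  { zero    → c , (λ j → sym (agree j refl))
  ; (suc l) → spans l }
...   | inj₂ (x , _ , Mf⟂x , M₀x≡1) = suc r , zero ∷ (suc ∘ f) , LinIndep-∷ (M zero) indep Mf⟂x M₀x≡1 , λ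
  { zero    → (true ∷ const false) ,
              (λ j → sym (trans (cong (M zero j xor_) (Σ₂-zero r (λ _ → refl))) (xor-identityʳ _)))
  ; (suc l) → (false ∷ proj₁ (spans l)) , proj₂ (spans l) }

rank : ∀ {m n} → Mat Bool m n → ℕ
rank {m} M = proj₁ (basis m M)

rank-isRank : ∀ {m n} (M : Mat Bool m n) → IsRank M (rank M)
rank-isRank {m} M with basis m M
... | r , f , indep , spans = (f , indep) , λ k g g-indep → LinIndep-SpannedBy⇒≤ (spans ∘ g) g-indep

IsRank-≤ : ∀ {m n} {M : Mat Bool m n} {r s} → IsRank M r → IsRank M s → r ≤ s
IsRank-≤ ((f , f-indep) , _) (_ , maximal) = maximal _ f f-indep

IsRank-mono : ∀ {m k n} {C : Mat Bool m n} {H : Mat Bool k n} {r s} →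
              SpannedBy C H → IsRank C r → IsRank H s → r ≤ s
IsRank-mono {k = k} {H = H} C≤H ((g , g-indep) , _) (_ , H-maximal) with basis k H
... | r′ , f , f-indep , spans =
  ≤-trans (LinIndep-SpannedBy⇒≤ (SpannedBy-trans (C≤H ∘ g) spans) g-indep) (H-maximal r′ f f-indep)

_≐_ : ∀ {X : Set} {m n} → Mat X m n → Mat X m n → Set
M ≐ M′ = ∀ i → M i ≗ M′ i

IsRank-resp-≐ : ∀ {m n} {M M′ : Mat Bool m n} {r} → M ≐ M′ → IsRank M r → IsRank M′ r
IsRank-resp-≐ M≐M′ ((f , f-indep) , maximal) =
  (f , LinIndep-resp (M≐M′ ∘ f) f-indep) ,
  (λ k g g-indep → maximal k g (LinIndep-resp (λ i j → sym (M≐M′ (g i) j)) g-indep))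

rank-resp-≐ : ∀ {m n} {M M′ : Mat Bool m n} → M ≐ M′ → rank M ≡ rank M′
rank-resp-≐ {M = M} {M′} M≐M′ =
  ≤-antisym (IsRank-≤ {M = M′} rank-M′ (rank-isRank M′)) (IsRank-≤ {M = M′} (rank-isRank M′) rank-M′)
  where
  rank-M′ : IsRank M′ (rank M)
  rank-M′ = IsRank-resp-≐ {M = M} M≐M′ (rank-isRank M)

functions : ∀ {A : Set} → List A → ∀ k → List (Fin k → A)
functions xs zero    = List.[ [] ]
functions xs (suc k) = cartesianProductWith _∷_ xs (functions xs k)

functions-complete : ∀ {A : Set} (_≈_ : A → A → Set) {xs : List A} →
                     (∀ a → ∃[ a′ ] a′ ∈ xs × a ≈ a′) →
                     ∀ k (f : Fin k → A) → ∃[ f′ ] f′ ∈ functions xs k × (∀ i → f i ≈ f′ i)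
functions-complete _≈_ complete zero    f = [] , here refl , λ ()
functions-complete _≈_ complete (suc k) f
  with complete (f zero) | functions-complete _≈_ complete k (f ∘ suc)
... | a , a∈ , fa≈a | g , g∈ , f≈g =
  a ∷ g , ∈-cartesianProductWith⁺ _∷_ a∈ g∈ , λ { zero → fa≈a ; (suc i) → f≈g i }

bools : List Bool
bools = false List.∷ true List.∷ List.[]

bools-complete : ∀ b → ∃[ b′ ] b′ ∈ bools × b ≡ b′
bools-complete false = false , here refl , refl
bools-complete true  = true , there (here refl) , refl

matrices : ∀ m n → List (Mat Bool m n)
matrices m n = functions (functions bools n) m

matrices-complete : ∀ {m n} (M : Mat Bool m n) → ∃[ M′ ] M′ ∈ matrices m n × M ≐ M′
matrices-complete {m} {n} = functions-complete _≗_ (functions-complete _≡_ bools-complete n) m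

minimal-matrix : ∀ {m n} {P : Mat Bool m n → Set} → Decidable P →
                 (∀ {M M′} → M ≐ M′ → P M → P M′) →
                 (μ : Mat Bool m n → ℕ) → (∀ {M M′} → M ≐ M′ → μ M ≡ μ M′) →
                 ∀ {M₀} → P M₀ → ∃[ M ] P M × (∀ M′ → P M′ → μ M ≤ μ M′)
minimal-matrix {m} {n} {P} P? P-resp μ μ-resp {M₀} PM₀ = M , PM , minimal
  where
  candidates : List (Mat Bool m n)
  candidates = filter P? (matrices m n)
  M : Mat Bool m n
  M = argmin μ M₀ candidates
  PM : P M
  PM = argmin-all μ PM₀ (all-filter P? (matrices m n))
  minimal : ∀ M′ → P M′ → μ M ≤ μ M′
  minimal M′ PM′ with matrices-complete M′
  ... | M″ , M″∈ , M′≐M″ =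
    subst (μ M ≤_) (sym (μ-resp M′≐M″))
          (All.lookup (f[argmin]≤f[xs] M₀ candidates) (∈-filter⁺ P? M″∈ (P-resp M′≐M″ PM′)))

agrees? : ∀ e b → Dec (Agrees e b)
agrees? 𝟘 false = yes agree𝟘
agrees? 𝟘 true  = no λ ()
agrees? 𝟙 true  = yes agree𝟙
agrees? 𝟙 false = no λ ()
agrees? ∗ b     = yes (agree∗ b)

completion? : ∀ {m n} (A : Mat Entry m n) → Decidable (IsCompletion A)
completion? A C = all? λ i → all? λ j → agrees? (A i j) (C i j)

IsCompletion-resp-≐ : ∀ {m n} {A : Mat Entry m n} {C C′ : Mat Bool m n} →
                      C ≐ C′ → IsCompletion A C → IsCompletion A C′
IsCompletion-resp-≐ {A = A} C≐C′ C-comp i j = subst (Agrees (A i j)) (C≐C′ i j) (C-comp i j)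

rowVec-isCompletion : ∀ {m n} (A : Mat Entry m n) → IsCompletion A (rowVec A)
rowVec-isCompletion A i j = agrees-starToZero (A i j)
  where
  agrees-starToZero : ∀ e → Agrees e (starToZero e)
  agrees-starToZero 𝟘 = agree𝟘
  agrees-starToZero 𝟙 = agree𝟙
  agrees-starToZero ∗ = agree∗ false

D-· : ∀ {m n} (A : Mat Entry m n) i (x : Vec₂ n) j → (D A i · x) j ≡ isStar (A i j) ∧ x j
D-· {n = suc n} A i x j = trans (Σ₂-single _ j off-diagonal) on-diagonal
  where
  off-diagonal : ∀ j′ → j′ ≢ j → D A i j j′ ∧ x j′ ≡ false
  off-diagonal j′ j′≢j with j ≟ j′
  ... | yes j≡j′ = contradiction (sym j≡j′) j′≢j
  ... | no  _    = refl
  on-diagonal : D A i j j ∧ x j ≡ isStar (A i j) ∧ x j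
  on-diagonal with j ≟ j
  ... | yes _   = refl
  ... | no  j≢j = contradiction refl j≢j

agrees-off-star : ∀ {e b} → Agrees e b → ∀ y → isStar e ∧ y ≡ false → b ∧ y ≡ starToZero e ∧ y
agrees-off-star agree𝟘     y _     = refl
agrees-off-star agree𝟙     y _     = refl
agrees-off-star (agree∗ b) y y≡0   = trans (cong (b ∧_) y≡0) (∧-zeroʳ b)

agrees-if-≡-off-star : ∀ e b → (not (isStar e) ≡ true → b ≡ starToZero e) → Agrees e b
agrees-if-≡-off-star 𝟘 b b≡0 rewrite b≡0 refl = agree𝟘
agrees-if-≡-off-star 𝟙 b b≡1 rewrite b≡1 refl = agree𝟙
agrees-if-≡-off-star ∗ b _                    = agree∗ b

completion-separates : ∀ {m n} {A : Mat Entry m n} {C : Mat Bool m n} →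
                       IsCompletion A C → Separates A C
completion-separates {n = n} {A} {C} C-comp x (i , Dx≡0 , aᵢx≡1) Cx≡0 =
  contradiction (trans (sym aᵢx≡1) (trans (sym Cᵢx≡aᵢx) (Cx≡0 i))) λ ()
  where
  Cᵢx≡aᵢx : ⟨ C i , x ⟩ ≡ ⟨ rowVec A i , x ⟩
  Cᵢx≡aᵢx = Σ₂-cong n (λ j → agrees-off-star (C-comp i j) (x j) (trans (sym (D-· A i x j)) (Dx≡0 j)))

-- An obstruction for row i would be a vector of K_A annihilated by H.
separating⇒spanned-completion : ∀ {m n k} {A : Mat Entry m n} {H : Mat Bool k n} →
                                Separates A H → ∃[ C ] IsCompletion A C × SpannedBy C H
separating⇒spanned-completion {m} {n} {k} {A} {H} H-sep =
  (λ i → lincomb (coeffs i) H) ,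
  (λ i j → agrees-if-≡-off-star (A i j) _ (proj₂ (row-combination i) j)) ,
  (λ i → coeffs i , λ _ → refl)
  where
  nonStar : Fin m → Fin n → Bool
  nonStar i j = not (isStar (A i j))
  row-combination : ∀ i → ∃[ c ] AgreeOn (nonStar i) (lincomb c H) (rowVec A i)
  row-combination i with combination-or-obstruction k (nonStar i) H (rowVec A i)
  ... | inj₁ combination          = combination
  ... | inj₂ (x , x-off , H⟂x , aᵢx≡1) = contradiction H⟂x (H-sep x (i , Dx≡0 , aᵢx≡1))
    where
    Dx≡0 : IsZero (D A i · x)
    Dx≡0 j = trans (D-· A i x j) (star-or-zero (isStar (A i j)) (x-off j))
      where
      star-or-zero : ∀ s {y} → (not s ≡ false → y ≡ false) → s ∧ y ≡ false
      star-or-zero true  y≡0 = y≡0 refl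
      star-or-zero false _   = refl
  coeffs : Fin m → Fin k → Bool
  coeffs i = proj₁ (row-combination i)

corollary5 : ∀ m n (A : Mat Entry m n) → ∃[ r ] (IsMinRank A r × IsMinSepRank A r)
corollary5 m n A
  with minimal-matrix (completion? A) IsCompletion-resp-≐ rank rank-resp-≐ (rowVec-isCompletion A)
... | C , C-comp , C-minimal =
  rank C ,
  ((C , C-comp , rank-isRank C) , mr-minimal) ,
  ((m , C , completion-separates C-comp , rank-isRank C) , separating-minimal)
  where
  mr-minimal : ∀ C′ → IsCompletion A C′ → ∀ s → IsRank C′ s → rank C ≤ s
  mr-minimal C′ C′-comp s C′-rank = ≤-trans (C-minimal C′ C′-comp) (IsRank-≤ {M = C′} (rank-isRank C′) C′-rank)
  separating-minimal : ∀ k (H : Mat Bool k n) → Separates A H → ∀ s → IsRank H s → rank C ≤ s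
  separating-minimal k H H-sep s H-rank with separating⇒spanned-completion H-sep
  ... | C′ , C′-comp , C′≤H = ≤-trans (C-minimal C′ C′-comp) (IsRank-mono C′≤H (rank-isRank C′) H-rank)
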